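{- In the dynamic network model described in the context, restricted to topology changes that are edge insertions, node deletions, or edge deletions, the deterministic $1$-round bandwidth complexity of $\mathsf{List}(\Gamma)$ (listing induced wedges) is $O(\log n)$, where $n$ is the current number of nodes. That is, there is a deterministic algorithm in which each node sends each neighbor $O(\log n)$ bits per round, and after the single round of communication following each topology change every induced wedge of the current graph is listed by at least one of its nodes and no set of three nodes that is not an induced wedge of the current graph is listed as one.
   Context: Dynamic network model: the network is a sequence of graphs $(G_0, G_1, \dots, G_r)$. All nodes of the initial graph $G_0$ know its complete topology. Each $G_i$ is either identical to $G_{i-1}$ or differs from it by a single topology change of an allowed type: edge insertion, edge deletion, node insertion (together with all its incident edges), or node deletion (together with all its incident edges). Each node has a unique ID of $O(\log n)$ bits, where $n$ is the current number of nodes, and knows the IDs of its current neighbors. Communication is synchronous. Each round consists of: (1) the topology change occurs, and each node learns its new neighbor list; (2) each node sends to each of its current neighbors a message of at most $B$ bits (messages to different neighbors may differ), where $B$ is the bandwidth; (3) nodes receive messages and output their lists. A deleted node sends nothing and lists nothing. An induced wedge on nodes $\{u,v,w\}$ is a path $(u,v,w)$ of length 2 (edges $\{u,v\},\{v,w\}$ present) such that the edge $\{u,w\}$ is absent; $\Gamma$ denotes the induced wedge. For a graph $H$, the problem $\mathsf{List}(H)$ requires that in each round, every induced copy of $H$ in the current graph $G_i$ be listed (the IDs of its nodes output) by at least one of its nodes, and that every listed set induce a copy of $H$ in $G_i$. The deterministic $1$-round bandwidth complexity is the minimum bandwidth $B$ for which there is a deterministic algorithm whose output at every node is correct after one round of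 communication following each topology change. -}

module Defs where

open import Data.Nat using (ℕ; zero; suc; _+_; _*_; _^_; _≤_; _<_; _≡ᵇ_)
open import Data.Nat.Logarithm using (⌈log₂_⌉)
open import Data.Bool using (Bool; true; false; _∧_; _∨_; not; if_then_else_)
open import Data.List using (List; []; length)
open import Data.List.Membership.Propositional using (_∈_)
open import Data.List.Relation.Unary.Unique.Propositional using (Unique)
open import Data.Product using (Σ; ∃; _×_; _,_)
open import Data.Sum using (_⊎_)
open import Relation.Binary.PropositionalEquality using (_≡_; _≢_)

-- Graphs.  Nodes are identified with their (unique) IDs, natural numbers.

record Graph : Set where
  field
    V      : List ℕ
    V-uniq : Unique V
    E      : ℕ → ℕ → Bool
    E-sym  : ∀ u v → E u v ≡ E v u
    E-irr  : ∀ u → E u u ≡ false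
    E-V    : ∀ u v → E u v ≡ true → u ∈ V

open Graph public

size : Graph → ℕ
size G = length (V G)

_⇔_ : Set → Set → Set
A ⇔ B = (A → B) × (B → A)

SameNodes : Graph → Graph → Set
SameNodes G G' = ∀ x → (x ∈ V G) ⇔ (x ∈ V G')

isPair : ℕ → ℕ → ℕ → ℕ → Bool
isPair u v x y = ((x ≡ᵇ u) ∧ (y ≡ᵇ v)) ∨ ((x ≡ᵇ v) ∧ (y ≡ᵇ u))

data Step (G G' : Graph) : Set where
  no-change  : SameNodes G G' → (∀ x y → E G' x y ≡ E G x y) → Step G G'
  edge-ins   : (u v : ℕ) → u ∈ V G → v ∈ V G → u ≢ v → E G u v ≡ false →
               SameNodes G G' →
               (∀ x y → E G' x y ≡ (E G x y ∨ isPair u v x y)) → Step G G'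
  edge-del   : (u v : ℕ) → E G u v ≡ true →
               SameNodes G G' →
               (∀ x y → E G' x y ≡ (E G x y ∧ not (isPair u v x y))) → Step G G'
  node-del   : (u : ℕ) → u ∈ V G →
               (∀ x → (x ∈ V G') ⇔ ((x ∈ V G) × (x ≢ u))) →
               (∀ x y → E G' x y ≡ (E G x y ∧ (not (x ≡ᵇ u) ∧ not (y ≡ᵇ u)))) →
               Step G G'

ValidSeq : (ℕ → Graph) → Set
ValidSeq Gs = ∀ i → Step (Gs i) (Gs (suc i))

-- IDs have O(log n) bits (constant d), n the current number of nodes.
IDsBounded : ℕ → (ℕ → Graph) → Set
IDsBounded d Gs = ∀ i u → u ∈ V (Gs i) → u < 2 ^ (d * (1 + ⌈log₂ size (Gs i) ⌉))

IsInducedWedge : Graph → ℕ → ℕ → ℕ → Set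
IsInducedWedge G a b c =
  (a ∈ V G) × (b ∈ V G) × (c ∈ V G) × (a ≢ c) ×
  (E G a b ≡ true) × (E G b c ≡ true) × (E G a c ≡ false)

InducesWedge : Graph → ℕ → ℕ → ℕ → Set
InducesWedge G x y z =
  IsInducedWedge G y x z ⊎ IsInducedWedge G x y z ⊎ IsInducedWedge G x z y

In3 : ℕ → ℕ → ℕ → ℕ → Set
In3 w a b c = (w ≡ a) ⊎ (w ≡ b) ⊎ (w ≡ c)

SameSet3 : ℕ × ℕ × ℕ → ℕ → ℕ → ℕ → Set
SameSet3 (p , q , r) a b c = ∀ w → In3 w p q r ⇔ In3 w a b c

Msg : Set
Msg = List Bool

record Algorithm : Set₁ where
  field
    State   : Set
    -- initial state from own ID and the complete topology of G_0
    init    : ℕ → Graph → State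
    -- message to neighbour v, given state and current neighbour set
    send    : State → (ℕ → Bool) → ℕ → Msg
    -- update, given current neighbour set and received messages (by sender)
    receive : State → (ℕ → Bool) → (ℕ → Msg) → State
    output  : State → List (ℕ × ℕ × ℕ)

open Algorithm public

-- state of node u after round i (round i: change to G_i, one
-- communication round on G_i, then output)
state : (A : Algorithm) → (ℕ → Graph) → ℕ → ℕ → State A
state A Gs zero    u = init A u (Gs zero)
state A Gs (suc i) u =
  receive A (state A Gs i u) (E (Gs (suc i)) u)
    (λ v → if E (Gs (suc i)) u v
           then send A (state A Gs i v) (E (Gs (suc i)) v) u
           else [])

-- message sent by u to v in round (suc i)
message : (A : Algorithm) → (ℕ → Graph) → ℕ → ℕ → ℕ → Msg
message A Gs i u v = send A (state A Gs i u) (E (Gs (suc i)) u) v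

BandwidthOK : ℕ → Algorithm → (ℕ → Graph) → Set
BandwidthOK C A Gs =
  ∀ i u v → u ∈ V (Gs (suc i)) → E (Gs (suc i)) u v ≡ true →
  length (message A Gs i u v) ≤ C * ⌈log₂ size (Gs (suc i)) ⌉

Complete : Algorithm → (ℕ → Graph) → Set
Complete A Gs =
  ∀ i a b c → IsInducedWedge (Gs (suc i)) a b c →
  Σ ℕ λ x → In3 x a b c × (x ∈ V (Gs (suc i))) ×
    (Σ (ℕ × ℕ × ℕ) λ t → (t ∈ output A (state A Gs (suc i) x)) × SameSet3 t a b c)

Sound : Algorithm → (ℕ → Graph) → Set
Sound A Gs =
  ∀ i x → x ∈ V (Gs (suc i)) → ∀ p q r →
  (p , q , r) ∈ output A (state A Gs (suc i) x) → InducesWedge (Gs (suc i)) p q r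

{-# OPTIONS --safe #-}
module Submission where

-- Without node insertions, every topology change alters the neighbourhood of a
-- surviving node in at most one position, so each node can describe its change
-- to all neighbours by one ID and one bit.  A node x keeps, for each neighbour y,
-- a view of y's adjacency that is never wrong but may be incomplete; x lists
-- (x, y, z) when y is a neighbour, z is not, and its view says y ~ z.  Every
-- induced wedge x - y - z is then seen from x or from z: if x ~ y is new, y's
-- announcement of x reaches z, who already knew y ~ z; if y ~ z is new, x hears
-- of it; and if both edges are old, the invariant was already in force.

open import Data.Bool using (Bool; true; false; _∧_; _∨_; not; if_then_else_)
open import Data.Bool.Properties using (∧-conicalˡ; ∧-conicalʳ; ∧-identityʳ; ∨-identityʳ; T-≡; T-∧; T-∨)
  renaming (_≟_ to _≟ᵇ_)
open import Data.Empty using (⊥-elim)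
open import Data.List using (List; []; _∷_; length; map; filter; find; cartesianProduct)
open import Data.List.Membership.Propositional using (_∈_)
open import Data.List.Membership.Propositional.Properties
  using (∈-map⁺; ∈-map⁻; ∈-filter⁺; ∈-filter⁻; ∈-cartesianProduct⁺)
open import Data.List.Properties using (filter-notAll)
open import Data.List.Relation.Unary.All as All using ([]; _∷_)
open import Data.List.Relation.Unary.AllPairs using ([]; _∷_)
open import Data.List.Relation.Unary.Any as Any using (here; there)
open import Data.List.Relation.Unary.Unique.Propositional using (Unique)
open import Data.Maybe using (just; nothing)
open import Data.Nat using (ℕ; zero; suc; _+_; _*_; _^_; _≤_; _<_; _≡ᵇ_; z≤n; s≤s; >-nonZero)
open import Data.Nat.DivMod using (_/_; _%_; m≡m%n+[m/n]*n; m%n<n; m/n<m; m<n*o⇒m/o<n)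
open import Data.Nat.Logarithm using (⌈log₂_⌉; ⌈log₂⌉-mono-≤; ⌈log₂2*n⌉≡1+⌈log₂n⌉; ⌈log₂2^n⌉≡n)
open import Data.Nat.Properties
  using (_≟_; ≡ᵇ⇒≡; ≤-refl; ≤-trans; ≤-pred; n≤1+n; m≤m+n; m<m*n; *-comm; *-monoʳ-≤; ^-monoʳ-≤
        ; module ≤-Reasoning)
open import Data.Nat.Tactic.RingSolver using (solve-∀)
open import Data.Product using (Σ; ∃; ∃₂; _×_; _,_; proj₁; proj₂; uncurry)
open import Data.Sum using (_⊎_; inj₁; inj₂; [_,_])
open import Function using (_∘_; id; Equivalence)
open import Relation.Binary using (DecidableEquality)
open import Relation.Binary.PropositionalEquality
  using (_≡_; _≢_; refl; sym; trans; cong; cong₂; subst; module ≡-Reasoning)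
open import Relation.Nullary using (Dec; yes; no; ¬_; ¬?; _×-dec_)
open import Relation.Nullary.Decidable using (dec-false)
open import Relation.Unary using (Decidable)

open import Defs

open Equivalence using (to; from)

true≢false : true ≢ false
true≢false ()

∧-intro : ∀ {a b} → a ≡ true → b ≡ true → a ∧ b ≡ true
∧-intro refl refl = refl

≢⇒either-true : ∀ {a b} → a ≢ b → a ≡ true ⊎ b ≡ true
≢⇒either-true {true}           _   = inj₁ refl
≢⇒either-true {false} {true}   _   = inj₂ refl
≢⇒either-true {false} {false} a≢b = ⊥-elim (a≢b refl)

switched-on : ∀ {a b : Bool} p → (p ≡ false → b ≡ a) → a ≢ b → p ≡ true
switched-on true  _     _   = refl
switched-on false b≡a a≢b = ⊥-elim (a≢b (sym (b≡a refl)))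

≡ᵇ-true⇒≡ : ∀ m n → (m ≡ᵇ n) ≡ true → m ≡ n
≡ᵇ-true⇒≡ m n e = ≡ᵇ⇒≡ m n (from T-≡ e)

module _ {A : Set} {P : A → Set} (P? : Decidable P) where

  find-just : ∀ xs {x} → find P? xs ≡ just x → x ∈ xs × P x
  find-just (y ∷ xs) e with P? y
  find-just (y ∷ xs) refl | yes py = here refl , py
  ... | no _ = let x∈xs , px = find-just xs e in there x∈xs , px

  find-nothing : ∀ xs → find P? xs ≡ nothing → ∀ {x} → x ∈ xs → ¬ P x
  find-nothing (y ∷ xs) e x∈ with P? y
  find-nothing (y ∷ xs) () x∈         | yes _
  find-nothing (y ∷ xs) e (here refl) | no ¬py = ¬py
  find-nothing (y ∷ xs) e (there x∈)  | no _   = find-nothing xs e x∈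

module _ {A : Set} (_≟ᴬ_ : DecidableEquality A) where

  Unique-⊆⇒length-≤ : ∀ {xs ys : List A} →
    Unique xs → (∀ {z} → z ∈ xs → z ∈ ys) → length xs ≤ length ys
  Unique-⊆⇒length-≤ {[]}     _               _     = z≤n
  Unique-⊆⇒length-≤ {x ∷ xs} {ys} (x∉xs ∷ uniq) xs⊆ys = begin-strict
    length xs                     ≤⟨ Unique-⊆⇒length-≤ uniq xs⊆ys-x ⟩
    length (filter (_≢? x) ys)    <⟨ filter-notAll (_≢? x) ys x∈ys ⟩
    length ys                     ∎
    where
    open ≤-Reasoning
    _≢?_ : ∀ z y → Dec (z ≢ y)
    z ≢? y = ¬? (z ≟ᴬ y)
    x∈ys = Any.map (λ x≡z z≢x → z≢x (sym x≡z)) (xs⊆ys (here refl))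
    xs⊆ys-x : ∀ {z} → z ∈ xs → z ∈ filter (_≢? x) ys
    xs⊆ys-x z∈xs = ∈-filter⁺ (_≢? x) (xs⊆ys (there z∈xs)) (All.lookup x∉xs z∈xs ∘ sym)

-- Binary encoding of IDs

fromBits : List Bool → ℕ
fromBits []       = 0
fromBits (b ∷ bs) = (if b then 1 else 0) + 2 * fromBits bs

-- The first argument is fuel; fuel n suffices for n.
toBits′ : ℕ → ℕ → List Bool
toBits′ zero    _       = []
toBits′ (suc f) zero    = []
toBits′ (suc f) (suc m) = (suc m % 2 ≡ᵇ 1) ∷ toBits′ f (suc m / 2)

toBits : ℕ → List Bool
toBits n = toBits′ n n

fromBits-toBits′ : ∀ f n → n ≤ f → fromBits (toBits′ f n) ≡ n
fromBits-toBits′ zero    zero    _         = refl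
fromBits-toBits′ (suc f) zero    _         = refl
fromBits-toBits′ (suc f) (suc m) (s≤s m≤f) = begin
  (if r ≡ᵇ 1 then 1 else 0) + 2 * fromBits (toBits′ f q)
    ≡⟨ cong₂ _+_ (bit (m%n<n (suc m) 2)) (cong (2 *_) (fromBits-toBits′ f q q≤f)) ⟩
  r + 2 * q                                               ≡⟨ cong (r +_) (*-comm 2 q) ⟩
  r + q * 2                                               ≡⟨ sym (m≡m%n+[m/n]*n (suc m) 2) ⟩
  suc m                                                   ∎
  where
  open ≡-Reasoning
  r = suc m % 2
  q = suc m / 2
  bit : ∀ {r} → r < 2 → (if r ≡ᵇ 1 then 1 else 0) ≡ r
  bit {0} _ = refl
  bit {1} _ = refl
  bit {suc (suc _)} (s≤s (s≤s ()))
  q≤f : q ≤ f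
  q≤f = ≤-pred (≤-trans (m/n<m (suc m) 2 (s≤s (s≤s z≤n))) (s≤s m≤f))

fromBits-toBits : ∀ n → fromBits (toBits n) ≡ n
fromBits-toBits n = fromBits-toBits′ n n ≤-refl

length-toBits′ : ∀ f k n → n < 2 ^ k → length (toBits′ f n) ≤ k
length-toBits′ zero    k       _       _  = z≤n
length-toBits′ (suc f) k       zero    _  = z≤n
length-toBits′ (suc f) zero    (suc m) (s≤s ())
length-toBits′ (suc f) (suc k) (suc m) lt =
  s≤s (length-toBits′ f k (suc m / 2) (m<n*o⇒m/o<n (subst (suc m <_) (*-comm 2 (2 ^ k)) lt)))

length-toBits : ∀ k n → n < 2 ^ k → length (toBits n) ≤ k
length-toBits k n = length-toBits′ n k n

-- Messages announcing a single change of a Boolean function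

data Describes (old new : ℕ → Bool) : Msg → Set where
  unchanged  : (∀ z → new z ≡ old z) → Describes old new []
  changed-at : ∀ b bs → new (fromBits bs) ≡ b → (∀ z → z ≢ fromBits bs → new z ≡ old z) →
               Describes old new (b ∷ bs)

patch : (ℕ → Bool) → Msg → ℕ → Bool
patch k []       z = k z
patch k (b ∷ bs) z with z ≟ fromBits bs
... | yes _ = b
... | no  _ = k z

module _ {old new : ℕ → Bool} (k : ℕ → Bool) where

  patch-sound : ∀ {m} → Describes old new m →
    (∀ z → k z ≡ true → old z ≡ true) → ∀ z → patch k m z ≡ true → new z ≡ true
  patch-sound (unchanged same) k⊆old z p = trans (same z) (k⊆old z p)
  patch-sound (changed-at b bs new≡b same) k⊆old z p with z ≟ fromBits bs
  ... | yes refl = trans new≡b p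
  ... | no z≢    = trans (same z z≢) (k⊆old z p)

  patch-complete : ∀ {m} → Describes old new m →
    ∀ z → new z ≡ true → (old z ≡ true → k z ≡ true) → patch k m z ≡ true
  patch-complete (unchanged same) z nz old⇒k = old⇒k (trans (sym (same z)) nz)
  patch-complete (changed-at b bs new≡b same) z nz old⇒k with z ≟ fromBits bs
  ... | yes refl = trans (sym new≡b) nz
  ... | no z≢    = old⇒k (trans (sym (same z z≢)) nz)

Changed : (ℕ → Bool) → (ℕ → Bool) → ℕ → Set
Changed old new z = old z ≢ new z

changed? : ∀ old new → Decidable (Changed old new)
changed? old new z = ¬? (old z ≟ᵇ new z)

announce : List ℕ → (ℕ → Bool) → (ℕ → Bool) → Msg
announce xs old new with find (changed? old new) xs
... | nothing = []
... | just z  = new z ∷ toBits z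

announce-describes : ∀ xs old new →
  (∀ {z} → Changed old new z → z ∈ xs) →
  (∀ {z₁ z₂} → Changed old new z₁ → Changed old new z₂ → z₁ ≡ z₂) →
  Describes old new (announce xs old new)
announce-describes xs old new changes⊆xs unique with find (changed? old new) xs in found
... | nothing = unchanged same
  where
  same : ∀ z → new z ≡ old z
  same z with old z ≟ᵇ new z
  ... | yes eq = sym eq
  ... | no  ch = ⊥-elim (find-nothing (changed? old new) xs found (changes⊆xs ch) ch)
... | just z₀ = changed-at (new z₀) (toBits z₀) (cong new (fromBits-toBits z₀)) same
  where
  ch₀ = proj₂ (find-just (changed? old new) xs found)
  same : ∀ z → z ≢ fromBits (toBits z₀) → new z ≡ old z
  same z z≢ with old z ≟ᵇ new z
  ... | yes eq = sym eq
  ... | no  ch = ⊥-elim (z≢ (trans (unique ch ch₀) (sym (fromBits-toBits z₀))))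

length-announce : ∀ xs old new k →
  (∀ {z} → Changed old new z → z < 2 ^ k) → length (announce xs old new) ≤ suc k
length-announce xs old new k bounded with find (changed? old new) xs in found
... | nothing = z≤n
... | just z₀ = s≤s (length-toBits k z₀ (bounded (proj₂ (find-just (changed? old new) xs found))))

E-flip : ∀ G {u v b} → E G u v ≡ b → E G v u ≡ b
E-flip G {u} {v} = trans (E-sym G v u)

E⇒∈ʳ : ∀ G {u v} → E G u v ≡ true → v ∈ V G
E⇒∈ʳ G {u} {v} = E-V G v u ∘ E-flip G

changed⇒∈ : ∀ G G′ {u z} → Changed (E G u) (E G′ u) z → z ∈ V G ⊎ z ∈ V G′
changed⇒∈ G G′ ch with ≢⇒either-true ch
... | inj₁ e = inj₁ (E⇒∈ʳ G e)
... | inj₂ e = inj₂ (E⇒∈ʳ G′ e)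

isPair-sound : ∀ u v x y → isPair u v x y ≡ true → (x ≡ u × y ≡ v) ⊎ (x ≡ v × y ≡ u)
isPair-sound u v x y e with to T-∨ (from T-≡ e)
... | inj₁ t = let tx , ty = to T-∧ t in inj₁ (≡ᵇ⇒≡ x u tx , ≡ᵇ⇒≡ y v ty)
... | inj₂ t = let tx , ty = to T-∧ t in inj₂ (≡ᵇ⇒≡ x v tx , ≡ᵇ⇒≡ y u ty)

isPair-functional : ∀ u v y {z₁ z₂} → isPair u v y z₁ ≡ true → isPair u v y z₂ ≡ true → z₁ ≡ z₂
isPair-functional u v y {z₁} {z₂} e₁ e₂ with isPair-sound u v y z₁ e₁ | isPair-sound u v y z₂ e₂
... | inj₁ (refl , refl) | inj₁ (_ , refl)    = refl
... | inj₁ (refl , refl) | inj₂ (refl , refl) = refl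
... | inj₂ (refl , refl) | inj₁ (refl , refl) = refl
... | inj₂ (refl , refl) | inj₂ (_ , refl)    = refl

IsInducedWedge-reverse : ∀ G {a b c} → IsInducedWedge G a b c → IsInducedWedge G c b a
IsInducedWedge-reverse G (a∈ , b∈ , c∈ , a≢c , eab , ebc , eac) =
  c∈ , b∈ , a∈ , a≢c ∘ sym , E-flip G ebc , E-flip G eab , E-flip G eac

In3-reverse : ∀ {w a b c} → In3 w c b a → In3 w a b c
In3-reverse (inj₁ w≡c)        = inj₂ (inj₂ w≡c)
In3-reverse (inj₂ (inj₁ w≡b)) = inj₂ (inj₁ w≡b)
In3-reverse (inj₂ (inj₂ w≡a)) = inj₁ w≡a

module _ {G G′ : Graph} where

  step-⊆ : Step G G′ → ∀ {z} → z ∈ V G′ → z ∈ V G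
  step-⊆ (no-change same _)           = proj₂ (same _)
  step-⊆ (edge-ins _ _ _ _ _ _ same _) = proj₂ (same _)
  step-⊆ (edge-del _ _ _ same _)       = proj₂ (same _)
  step-⊆ (node-del _ _ nodes _)        = proj₁ ∘ proj₁ (nodes _)

  step-size : Step G G′ → size G ≤ suc (size G′)
  step-size s = Unique-⊆⇒length-≤ _≟_ (V-uniq G) (proj₂ (lost s))
    where
    lost : Step G G′ → ∃ λ w → ∀ {z} → z ∈ V G → z ∈ w ∷ V G′
    lost (no-change same _)           = 0 , there ∘ proj₁ (same _)
    lost (edge-ins _ _ _ _ _ _ same _) = 0 , there ∘ proj₁ (same _)
    lost (edge-del _ _ _ same _)       = 0 , there ∘ proj₁ (same _)
    lost (node-del u _ nodes _)        = u , λ {z} z∈ → kept-or-u z∈ (z ≟ u)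
      where
      kept-or-u : ∀ {z} → z ∈ V G → Dec (z ≡ u) → z ∈ u ∷ V G′
      kept-or-u _  (yes z≡u) = here z≡u
      kept-or-u z∈ (no  z≢u) = there (proj₂ (nodes _) (z∈ , z≢u))

  changed-unique : Step G G′ → ∀ {y} → y ∈ V G′ →
    ∀ {z₁ z₂} → Changed (E G y) (E G′ y) z₁ → Changed (E G y) (E G′ y) z₂ → z₁ ≡ z₂
  changed-unique (no-change _ same) _ ch₁ _ = ⊥-elim (ch₁ (sym (same _ _)))
  changed-unique (edge-ins u v _ _ _ _ _ edges) {y} _ ch₁ ch₂ =
    isPair-functional u v y (on ch₁) (on ch₂)
    where
    on : ∀ {z} → Changed (E G y) (E G′ y) z → isPair u v y z ≡ true
    on {z} = switched-on _ λ off → trans (edges y z) (trans (cong (E G y z ∨_) off) (∨-identityʳ _))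
  changed-unique (edge-del u v _ _ edges) {y} _ ch₁ ch₂ =
    isPair-functional u v y (on ch₁) (on ch₂)
    where
    on : ∀ {z} → Changed (E G y) (E G′ y) z → isPair u v y z ≡ true
    on {z} = switched-on _ λ off → trans (edges y z) (trans (cong (λ p → E G y z ∧ not p) off) (∧-identityʳ _))
  changed-unique (node-del u _ nodes edges) {y} y∈ ch₁ ch₂ = trans (is-u ch₁) (sym (is-u ch₂))
    where
    y≢u = proj₂ (proj₁ (nodes y) y∈)
    is-u : ∀ {z} → Changed (E G y) (E G′ y) z → z ≡ u
    is-u {z} ch = ≡ᵇ-true⇒≡ z u (switched-on _ off⇒same ch)
      where
      off⇒same : (z ≡ᵇ u) ≡ false → E G′ y z ≡ E G y z
      off⇒same off = begin
        E G′ y z                                       ≡⟨ edges y z ⟩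
        E G y z ∧ (not (y ≡ᵇ u) ∧ not (z ≡ᵇ u))
          -- does (y ≟ u) computes to y ≡ᵇ u
          ≡⟨ cong₂ (λ p q → E G y z ∧ (not p ∧ not q)) (dec-false (y ≟ u) y≢u) off ⟩
        E G y z ∧ true                                 ≡⟨ ∧-identityʳ _ ⟩
        E G y z                                        ∎
        where open ≡-Reasoning

record NodeState : Set where
  field
    self   : ℕ
    nodes₀ : List ℕ
    adj    : ℕ → Bool
    -- view y z: whether this node believes y ~ z
    view   : ℕ → ℕ → Bool

open NodeState

SeesWedge : NodeState → ℕ → ℕ → Set
SeesWedge s y z = adj s y ≡ true × view s y z ≡ true × adj s z ≡ false × z ≢ self s

seesWedge? : ∀ s y z → Dec (SeesWedge s y z)
seesWedge? s y z = adj s y ≟ᵇ true ×-dec view s y z ≟ᵇ true ×-dec adj s z ≟ᵇ false ×-dec ¬? (z ≟ self s)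

candidates : NodeState → List (ℕ × ℕ)
candidates s = cartesianProduct (nodes₀ s) (nodes₀ s)

wedges : NodeState → List (ℕ × ℕ × ℕ)
wedges s = map (self s ,_) (filter (uncurry (seesWedge? s)) (candidates s))

wedges-sound : ∀ s {t} → t ∈ wedges s → ∃₂ λ y z → t ≡ (self s , y , z) × SeesWedge s y z
wedges-sound s t∈ with ∈-map⁻ (self s ,_) t∈
... | (y , z) , yz∈ , refl =
  y , z , refl , proj₂ (∈-filter⁻ (uncurry (seesWedge? s)) {xs = candidates s} yz∈)

wedges-complete : ∀ s {y z} → y ∈ nodes₀ s → z ∈ nodes₀ s → SeesWedge s y z → (self s , y , z) ∈ wedges s
wedges-complete s y∈ z∈ sees =
  ∈-map⁺ (self s ,_) (∈-filter⁺ (uncurry (seesWedge? s)) {xs = candidates s} (∈-cartesianProduct⁺ y∈ z∈) sees)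

wedgeLister : Algorithm
wedgeLister = record
  { State   = NodeState
  ; init    = λ u G → record { self = u ; nodes₀ = V G ; adj = E G u ; view = E G }
  ; send    = λ s adj′ _ → announce (nodes₀ s) (adj s) adj′
  ; receive = λ s adj′ ms → record s
      { adj  = adj′
      -- the view of a node that was not a neighbour before is stale: discard it
      ; view = λ y → patch (λ z → adj s y ∧ view s y z) (ms y) }
  ; output  = wedges
  }

1+d[2+L]≤[1+3d]L : ∀ d {L} → 1 ≤ L → suc (d * (2 + L)) ≤ (1 + 3 * d) * L
1+d[2+L]≤[1+3d]L d {suc l} _ = subst (suc (d * (2 + suc l)) ≤_) (sym (expand d l)) (m≤m+n _ _)
  where
  expand : ∀ d l → (1 + 3 * d) * suc l ≡ suc (d * (2 + suc l)) + (l + 2 * (d * l))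
  expand = solve-∀


module Run (Gs : ℕ → Graph) (valid : ValidSeq Gs) where

  S : ℕ → ℕ → NodeState
  S = state wedgeLister Gs

  self-S : ∀ i x → self (S i x) ≡ x
  self-S zero    x = refl
  self-S (suc i) x = self-S i x

  nodes₀-S : ∀ i x → nodes₀ (S i x) ≡ V (Gs 0)
  nodes₀-S zero    x = refl
  nodes₀-S (suc i) x = nodes₀-S i x

  adj-S : ∀ i x → adj (S i x) ≡ E (Gs i) x
  adj-S zero    x = refl
  adj-S (suc i) x = refl

  ⊆V₀ : ∀ i {z} → z ∈ V (Gs i) → z ∈ V (Gs 0)
  ⊆V₀ zero    = id
  ⊆V₀ (suc i) = ⊆V₀ i ∘ step-⊆ (valid i)

  message-describes : ∀ i y v → y ∈ V (Gs (suc i)) →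
    Describes (E (Gs i) y) (E (Gs (suc i)) y) (message wedgeLister Gs i y v)
  message-describes i y v y∈ rewrite nodes₀-S i y | adj-S i y =
    announce-describes _ _ _ ([ ⊆V₀ i , ⊆V₀ (suc i) ] ∘ changed⇒∈ (Gs i) (Gs (suc i)))
      (changed-unique (valid i) y∈)

  view-step : ∀ i x y → E (Gs (suc i)) x y ≡ true →
    view (S (suc i) x) y ≡ patch (λ z → E (Gs i) x y ∧ view (S i x) y z) (message wedgeLister Gs i y x)
  view-step i x y exy rewrite exy | adj-S i x = refl

  view-sound : ∀ i x y z → E (Gs i) x y ≡ true → view (S i x) y z ≡ true → E (Gs i) y z ≡ true
  view-sound zero    x y z _   seen = seen
  view-sound (suc i) x y z exy seen =
    patch-sound _ (message-describes i y x (E⇒∈ʳ (Gs (suc i)) exy)) old-sound z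
      (trans (sym (cong (λ f → f z) (view-step i x y exy))) seen)
    where
    old-sound : ∀ z → E (Gs i) x y ∧ view (S i x) y z ≡ true → E (Gs i) y z ≡ true
    old-sound z both = view-sound i x y z (∧-conicalˡ _ _ both) (∧-conicalʳ _ _ both)

  view-step-complete : ∀ i x y z → E (Gs (suc i)) x y ≡ true → E (Gs (suc i)) y z ≡ true →
    (E (Gs i) y z ≡ true → E (Gs i) x y ∧ view (S i x) y z ≡ true) → view (S (suc i) x) y z ≡ true
  view-step-complete i x y z exy eyz old⇒seen =
    trans (cong (λ f → f z) (view-step i x y exy))
      (patch-complete _ (message-describes i y x (E⇒∈ʳ (Gs (suc i)) exy)) z eyz old⇒seen)

  wedge-seen : ∀ i x y z → E (Gs i) x y ≡ true → E (Gs i) y z ≡ true → x ≢ z →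
    view (S i x) y z ≡ true ⊎ view (S i z) y x ≡ true
  wedge-seen zero x y z _ eyz _ = inj₁ eyz
  wedge-seen (suc i) x y z exy eyz x≢z with E (Gs i) x y in oxy | E (Gs i) y z in oyz
  ... | false | _     = inj₂ (view-step-complete i z y x (E-flip (Gs (suc i)) eyz) (E-flip (Gs (suc i)) exy)
                              λ oyx → ⊥-elim (true≢false (trans (sym oyx) (E-flip (Gs i) oxy))))
  ... | true  | false = inj₁ (view-step-complete i x y z exy eyz
                              λ oyz′ → ⊥-elim (true≢false (trans (sym oyz′) oyz)))
  ... | true  | true with wedge-seen i x y z oxy oyz x≢z
  ...   | inj₁ seen = inj₁ (view-step-complete i x y z exy eyz λ _ → ∧-intro oxy seen)
  ...   | inj₂ seen = inj₂ (view-step-complete i z y x (E-flip (Gs (suc i)) eyz) (E-flip (Gs (suc i)) exy)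
                              λ _ → ∧-intro (E-flip (Gs i) oyz) seen)

  sound : Sound wedgeLister Gs
  sound i x x∈ p q r t∈ with wedges-sound (S (suc i) x) t∈
  ... | y , z , refl , exy , seen , exz , z≢x =
    inj₂ (inj₁ (subst (λ w → IsInducedWedge (Gs (suc i)) w y z) (sym (self-S (suc i) x)) wedge))
    where
    eyz = view-sound (suc i) x y z exy seen
    wedge : IsInducedWedge (Gs (suc i)) x y z
    wedge = x∈ , E⇒∈ʳ (Gs (suc i)) exy , E⇒∈ʳ (Gs (suc i)) eyz ,
            (λ x≡z → z≢x (trans (sym x≡z) (sym (self-S (suc i) x)))) , exy , eyz , exz

  listed-by-endpoint : ∀ i {x y z} → IsInducedWedge (Gs (suc i)) x y z → view (S (suc i) x) y z ≡ true →
    (x , y , z) ∈ output wedgeLister (S (suc i) x)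
  listed-by-endpoint i {x} {y} {z} (_ , y∈ , z∈ , x≢z , exy , _ , exz) seen =
    subst (λ w → (w , y , z) ∈ wedges (S (suc i) x)) (self-S (suc i) x)
      (wedges-complete (S (suc i) x) (∈nodes₀ y∈) (∈nodes₀ z∈)
        (exy , seen , exz , λ z≡self → x≢z (sym (trans z≡self (self-S (suc i) x)))))
    where
    ∈nodes₀ : ∀ {w} → w ∈ V (Gs (suc i)) → w ∈ nodes₀ (S (suc i) x)
    ∈nodes₀ = subst (_ ∈_) (sym (nodes₀-S (suc i) x)) ∘ ⊆V₀ (suc i)

  complete : Complete wedgeLister Gs
  complete i a b c wedge@(a∈ , _ , c∈ , a≢c , eab , ebc , _) with wedge-seen (suc i) a b c eab ebc a≢c
  ... | inj₁ seen = a , inj₁ refl , a∈ , (a , b , c) , listed-by-endpoint i wedge seen ,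
                    λ _ → id , id
  ... | inj₂ seen = c , inj₂ (inj₂ refl) , c∈ , (c , b , a) ,
                    listed-by-endpoint i (IsInducedWedge-reverse (Gs (suc i)) wedge) seen ,
                    λ _ → In3-reverse , In3-reverse

  module _ (d : ℕ) (ids-bounded : IDsBounded d Gs) where

    bandwidth : BandwidthOK (1 + 3 * d) wedgeLister Gs
    bandwidth i u v u∈ euv = begin
      length (message wedgeLister Gs i u v)  ≤⟨ length-announce (nodes₀ (S i u)) _ _ (d * (2 + L)) bounded ⟩
      suc (d * (2 + L))                      ≤⟨ 1+d[2+L]≤[1+3d]L d 1≤L ⟩
      (1 + 3 * d) * L                        ∎
      where
      open ≤-Reasoning
      G = Gs i
      G′ = Gs (suc i)
      L = ⌈log₂ size G′ ⌉
      2≤size : 2 ≤ size G′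
      2≤size = Unique-⊆⇒length-≤ _≟_ ((u≢v ∷ []) ∷ [] ∷ [])
        λ { (here refl) → u∈ ; (there (here refl)) → E⇒∈ʳ G′ euv }
        where
        u≢v : u ≢ v
        u≢v refl = true≢false (trans (sym euv) (E-irr G′ u))
      1≤L : 1 ≤ L
      1≤L = subst (_≤ L) (⌈log₂2^n⌉≡n 1) (⌈log₂⌉-mono-≤ 2≤size)
      logG≤1+L : ⌈log₂ size G ⌉ ≤ suc L
      logG≤1+L = begin
        ⌈log₂ size G ⌉          ≤⟨ ⌈log₂⌉-mono-≤ (≤-trans (step-size (valid i)) 1+n≤2n) ⟩
        ⌈log₂ (2 * size G′) ⌉   ≡⟨ ⌈log₂2*n⌉≡1+⌈log₂n⌉ (size G′) {{nonZero}} ⟩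
        suc L                   ∎
        where
        nonZero = >-nonZero (≤-trans (s≤s z≤n) 2≤size)
        1+n≤2n : suc (size G′) ≤ 2 * size G′
        1+n≤2n = subst (suc (size G′) ≤_) (*-comm (size G′) 2) (m<m*n (size G′) 2 {{nonZero}} ≤-refl)
      ids-below : ∀ j → ⌈log₂ size (Gs j) ⌉ ≤ suc L → ∀ {z} → z ∈ V (Gs j) → z < 2 ^ (d * (2 + L))
      ids-below j log≤ z∈ = ≤-trans (ids-bounded j _ z∈) (^-monoʳ-≤ 2 (*-monoʳ-≤ d (s≤s log≤)))
      bounded : ∀ {z} → Changed (adj (S i u)) (E G′ u) z → z < 2 ^ (d * (2 + L))
      bounded ch with changed⇒∈ G G′ (subst (λ f → Changed f (E G′ u) _) (adj-S i u) ch)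
      ... | inj₁ z∈ = ids-below i logG≤1+L z∈
      ... | inj₂ z∈ = ids-below (suc i) (n≤1+n L) z∈

theorem2 : (d : ℕ) → Σ ℕ λ C → Σ Algorithm λ A →
    (Gs : ℕ → Graph) → ValidSeq Gs → IDsBounded d Gs →
    BandwidthOK C A Gs × Complete A Gs × Sound A Gs
theorem2 d = 1 + 3 * d , wedgeLister , λ Gs valid ids-bounded →
  let open Run Gs valid in bandwidth d ids-bounded , complete , sound
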